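{- Let $\mathbf{p}=(p_0,\ldots,p_k)$ and $\mathbf{q}=(q_0,\ldots,q_m)$ be two diagonal paths with the same initial height such that $\phi(\mathbf{w}(\mathbf{p}))=\phi(\mathbf{w}(\mathbf{q}))$. Then $\mathbf{p}$ and $\mathbf{q}$ have the same final height, and the multisets $\{\mathrm{ht}(p_i): 0\le i<k,\ p_i\nearrow p_{i+1}\}$ and $\{\mathrm{ht}(q_i): 0\le i<m,\ q_i\nearrow q_{i+1}\}$ are equal.
   Context: $\Bbbk$ is a field of characteristic $0$; $\mathcal{M}$ is the free monoid on letters $D,U$; $\mathcal{W}=\Bbbk\langle D,U\mid DU-UD=1\rangle$ is the Weyl algebra; $\phi:\mathcal{M}\to\mathcal{W}$ is the monoid morphism with $D\mapsto D,U\mapsto U$. A diagonal path is a sequence $(p_0,\ldots,p_k)$ of points of $\mathbb{Z}^2$ with each $p_{i+1}-p_i\in\{(1,1),(1,-1)\}$, written $p_i\nearrow p_{i+1}$ resp. $p_i\searrow p_{i+1}$. The height $\mathrm{ht}(p)$ of a point is its $y$-coordinate; initial/final height of the path are $\mathrm{ht}(p_0)$, $\mathrm{ht}(p_k)$. The reading word $\mathbf{w}(\mathbf{p})=w_0\cdots w_{k-1}$ has $w_i=U$ if $p_i\nearrow p_{i+1}$ and $w_i=D$ otherwise. -}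

module Defs where

open import Level using (Level; _⊔_) renaming (suc to lsuc)
open import Algebra.Bundles using (CommutativeRing)
open import Data.Nat using (ℕ; zero; suc)
open import Data.Integer using (ℤ) renaming (_+_ to _+ℤ_; _-_ to _-ℤ_)
import Data.Integer as Int
open import Data.Product using (_×_; _,_; proj₁; proj₂; Σ)
open import Data.List using (List; []; _∷_; _++_; map; foldr; [_])
open import Data.Bool using (Bool; true; false; if_then_else_)
open import Relation.Binary.PropositionalEquality using (_≡_)
open import Relation.Nullary using (¬_; yes; no)
open import Relation.Nullary.Decidable using (⌊_⌋)

record Field (c ℓ : Level) : Set (lsuc (c ⊔ ℓ)) where
  field
    commutativeRing : CommutativeRing c ℓ
  open CommutativeRing commutativeRing public
  field
    1≉0     : ¬ (1# ≈ 0#)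
    inverse : ∀ x → ¬ (x ≈ 0#) → Σ Carrier (λ y → (x * y) ≈ 1#)

natCast : ∀ {c ℓ} (K : Field c ℓ) → ℕ → Field.Carrier K
natCast K zero    = Field.0# K
natCast K (suc n) = Field._+_ K (Field.1# K) (natCast K n)

CharZero : ∀ {c ℓ} → Field c ℓ → Set ℓ
CharZero K = ∀ n → Field._≈_ K (natCast K n) (Field.0# K) → n ≡ 0

data Letter : Set where
  D U : Letter

Word : Set
Word = List Letter

letter-eq : Letter → Letter → Bool
letter-eq D D = true
letter-eq U U = true
letter-eq _ _ = false

word-eq : Word → Word → Bool
word-eq []       []       = true
word-eq (a ∷ v)  (b ∷ w)  = if letter-eq a b then word-eq v w else false
word-eq _        _        = false

-- The Weyl algebra W = K⟨D,U | DU - UD = 1⟩, as the free algebra K⟨D,U⟩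
-- modulo the two-sided ideal generated by DU - UD - 1.
-- Elements of the free algebra: formal linear combinations of words,
-- i.e. finite lists of (coefficient, word); two such are equal in the
-- free algebra iff every word has the same total coefficient.

module Weyl {c ℓ} (K : Field c ℓ) where
  open Field K

  FreeAlg : Set c
  FreeAlg = List (Carrier × Word)

  coeff : FreeAlg → Word → Carrier
  coeff []             w = 0#
  coeff ((a , v) ∷ f) w = if word-eq v w then a + coeff f w else coeff f w

  ι : Word → FreeAlg
  ι w = [ (1# , w) ]

  -- c · a (DU - UD - 1) b
  generator : Carrier × Word × Word → FreeAlg
  generator (k , a , b) =
    (k , a ++ D ∷ U ∷ b) ∷ (- k , a ++ U ∷ D ∷ b) ∷ (- k , a ++ b) ∷ []

  InIdeal : FreeAlg → Set (c ⊔ ℓ)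
  InIdeal f = Σ (List (Carrier × Word × Word)) λ gs →
    ∀ w → coeff f w ≈ coeff (Data.List.concatMap generator gs) w

  _⊖_ : FreeAlg → FreeAlg → FreeAlg
  f ⊖ g = f ++ map (λ { (k , v) → (- k , v) }) g

  -- φ(v) = φ(w) in W
  _≈φ_ : Word → Word → Set (c ⊔ ℓ)
  v ≈φ w = InIdeal (ι v ⊖ ι w)

-- Diagonal paths: initial point p₀ ∈ ℤ² together with the list of steps
-- p_i ↗ p_{i+1} (i.e. +(1,1)) or p_i ↘ p_{i+1} (i.e. +(1,-1)).

data Step : Set where
  ↗ ↘ : Step

record DiagPath : Set where
  constructor mkPath
  field
    start : ℤ × ℤ
    steps : List Step

Point : Set
Point = ℤ × ℤ

move : Step → Point → Point
move ↗ (x , y) = (x +ℤ Int.+ 1 , y +ℤ Int.+ 1)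
move ↘ (x , y) = (x +ℤ Int.+ 1 , y -ℤ Int.+ 1)

pointsFrom : Point → List Step → List Point
pointsFrom p []       = p ∷ []
pointsFrom p (s ∷ ss) = p ∷ pointsFrom (move s p) ss

points : DiagPath → List Point
points (mkPath p ss) = pointsFrom p ss

ht : Point → ℤ
ht = proj₂

endpoint : Point → List Step → Point
endpoint p []       = p
endpoint p (s ∷ ss) = endpoint (move s p) ss

initialHeight finalHeight : DiagPath → ℤ
initialHeight (mkPath p ss) = ht p
finalHeight   (mkPath p ss) = ht (endpoint p ss)

readStep : Step → Letter
readStep ↗ = U
readStep ↘ = D

readingWord : DiagPath → Word
readingWord (mkPath p ss) = map readStep ss

upHeightsFrom : Point → List Step → List ℤ
upHeightsFrom p []        = []
upHeightsFrom p (↗ ∷ ss) = ht p ∷ upHeightsFrom (move ↗ p) ss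
upHeightsFrom p (↘ ∷ ss) = upHeightsFrom (move ↘ p) ss

upHeights : DiagPath → List ℤ
upHeights (mkPath p ss) = upHeightsFrom p ss

-- Words act on integer-valued functions of the height: reading U at height h multiplies by
-- s - h and moves up, reading D moves down, and the empty word evaluates a terminal function t.
-- This action satisfies DU = UD + 1, and since ℤ embeds additively into a field of
-- characteristic 0, it takes the same value on words with the same image in W. On the
-- reading word of a path it is ∏ (s - a) · t(final height), the product running over the up
-- heights a. Taking t = 1, the two polynomials ∏ (s - a) agree at every integer s, so the two
-- multisets of roots coincide; taking t = id and s a non-root then equates the final heights.
module Submission where

open import Defs
open import Level using (Level)
import Algebra.Properties.CommutativeSemigroup as CommutativeSemigroupProperties
import Algebra.Properties.Ring as RingProperties
open import Data.Bool.Base using (true; false; if_then_else_)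
open import Data.Integer.Base as ℤ using (ℤ; +_; -[1+_]; 0ℤ; 1ℤ; NonZero; ≢-nonZero)
import Data.Integer.Properties as ℤ
open import Data.Integer.Tactic.RingSolver using (solve-∀)
open import Data.List.Base using (List; []; _∷_; _++_; [_]; length; map; concatMap)
open import Data.List.Extrema ℤ.≤-totalOrder using (max; xs≤max)
open import Data.List.Membership.Propositional using (_∈_; _∉_)
open import Data.List.Membership.Propositional.Properties using (∈-∃++)
open import Data.List.Properties using (∷-injective)
open import Data.List.Relation.Binary.Permutation.Propositional
  using (_↭_; ↭-refl; ↭-trans; ↭-sym; prep)
open import Data.List.Relation.Binary.Permutation.Propositional.Properties using (shift)
import Data.List.Relation.Unary.All as All
open import Data.List.Relation.Unary.Any using (here; there)
open import Data.Nat.Base as ℕ using (ℕ; zero; suc; _≤_; s≤s)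
open import Data.Nat.Induction using (<-wellFounded)
import Data.Nat.Properties as ℕ
open import Data.Product.Base using (∃-syntax; _×_; _,_; proj₁; proj₂)
open import Data.Sum.Base using (inj₁; inj₂)
open import Function.Base using (id; const; _∘_)
open import Induction.WellFounded using (Acc; acc)
open import Relation.Binary.PropositionalEquality
  using (_≡_; _≢_; refl; sym; trans; cong; cong₂; module ≡-Reasoning)
open import Relation.Nullary.Negation using (contradiction)
open import Relation.Nullary.Reflects using (Reflects; ofʸ; ofⁿ)

letter-eq-reflects : ∀ a b → Reflects (a ≡ b) (letter-eq a b)
letter-eq-reflects D D = ofʸ refl
letter-eq-reflects D U = ofⁿ λ ()
letter-eq-reflects U D = ofⁿ λ ()
letter-eq-reflects U U = ofʸ refl

word-eq-reflects : ∀ v w → Reflects (v ≡ w) (word-eq v w)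
word-eq-reflects []      []      = ofʸ refl
word-eq-reflects []      (_ ∷ _) = ofⁿ λ ()
word-eq-reflects (_ ∷ _) []      = ofⁿ λ ()
word-eq-reflects (a ∷ v) (b ∷ w) with letter-eq a b | letter-eq-reflects a b
... | false | ofⁿ a≢b  = ofⁿ (a≢b ∘ proj₁ ∘ ∷-injective)
... | true  | ofʸ refl with word-eq v w | word-eq-reflects v w
...   | false | ofⁿ v≢w  = ofⁿ (v≢w ∘ proj₂ ∘ ∷-injective)
...   | true  | ofʸ refl = ofʸ refl

word-eq-refl : ∀ v → word-eq v v ≡ true
word-eq-refl v with word-eq v v | word-eq-reflects v v
... | true  | _       = refl
... | false | ofⁿ v≢v = contradiction refl v≢v

module _ {c ℓ : Level} (K : Field c ℓ) where
  open Field K renaming (refl to ≈-refl; sym to ≈-sym; trans to ≈-trans)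
  open Weyl K using (FreeAlg; coeff; generator; ι; _⊖_; _≈φ_)
  open RingProperties ring
    using (-‿+-comm; -‿involutive; -1*x≈-x; -0#≈0#; +-identityˡ-unique; x∙y⁻¹≈ε⇒x≈y)
  open CommutativeSemigroupProperties +-commutativeSemigroup using (x∙yz≈y∙xz; interchange)
  open import Relation.Binary.Reasoning.Setoid setoid

  SameCoeffs : FreeAlg → FreeAlg → Set ℓ
  SameCoeffs f g = ∀ w → coeff f w ≈ coeff g w

  without : Word → FreeAlg → FreeAlg
  without v []            = []
  without v ((k , u) ∷ f) = if word-eq u v then without v f else (k , u) ∷ without v f

  length-without : ∀ v f → length (without v f) ≤ length f
  length-without v []            = ℕ.z≤n
  length-without v ((k , u) ∷ f) with word-eq u v
  ... | true  = ℕ.m≤n⇒m≤1+n (length-without v f)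
  ... | false = s≤s (length-without v f)

  length-without-head : ∀ k v f → length (without v ((k , v) ∷ f)) ℕ.< length ((k , v) ∷ f)
  length-without-head k v f rewrite word-eq-refl v = s≤s (length-without v f)

  coeff-∷-other : ∀ k u f w → u ≢ w → coeff ((k , u) ∷ f) w ≡ coeff f w
  coeff-∷-other k u f w u≢w with word-eq u w | word-eq-reflects u w
  ... | true  | ofʸ u≡w = contradiction u≡w u≢w
  ... | false | _       = refl

  coeff-without-self : ∀ v f → coeff (without v f) v ≈ 0#
  coeff-without-self v []            = ≈-refl
  coeff-without-self v ((k , u) ∷ f) with word-eq u v | word-eq-reflects u v
  ... | true  | _       = coeff-without-self v f
  ... | false | ofⁿ u≢v =
    ≈-trans (reflexive (coeff-∷-other k u (without v f) v u≢v)) (coeff-without-self v f)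

  coeff-without-other : ∀ v w f → v ≢ w → coeff (without v f) w ≈ coeff f w
  coeff-without-other v w []            v≢w = ≈-refl
  coeff-without-other v w ((k , u) ∷ f) v≢w with word-eq u v | word-eq-reflects u v
  ... | true  | ofʸ refl =
    ≈-trans (coeff-without-other v w f v≢w) (reflexive (sym (coeff-∷-other k v f w v≢w)))
  ... | false | _        with word-eq u w
  ...   | true  = +-congˡ (coeff-without-other v w f v≢w)
  ...   | false = coeff-without-other v w f v≢w

  without-sameCoeffs : ∀ v f g → SameCoeffs f g → SameCoeffs (without v f) (without v g)
  without-sameCoeffs v f g f≐g w with word-eq v w | word-eq-reflects v w
  ... | true  | ofʸ refl = ≈-trans (coeff-without-self v f) (≈-sym (coeff-without-self v g))
  ... | false | ofⁿ v≢w  = begin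
    coeff (without v f) w ≈⟨ coeff-without-other v w f v≢w ⟩
    coeff f w             ≈⟨ f≐g w ⟩
    coeff g w             ≈⟨ coeff-without-other v w g v≢w ⟨
    coeff (without v g) w ∎

  RespectsWeylRelation : (Word → Carrier) → Set ℓ
  RespectsWeylRelation val =
    ∀ a b → val (a ++ D ∷ U ∷ b) ≈ val (a ++ U ∷ D ∷ b) + val (a ++ b)

  module LinearExtension (val : Word → Carrier) where

    extend : FreeAlg → Carrier
    extend []            = 0#
    extend ((k , v) ∷ f) = k * val v + extend f

    extend-++ : ∀ f g → extend (f ++ g) ≈ extend f + extend g
    extend-++ []            g = ≈-sym (+-identityˡ (extend g))
    extend-++ ((k , v) ∷ f) g = ≈-trans (+-congˡ (extend-++ f g)) (≈-sym (+-assoc _ _ _))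

    extend-without : ∀ v f → extend f ≈ coeff f v * val v + extend (without v f)
    extend-without v []            = ≈-sym (≈-trans (+-congʳ (zeroˡ (val v))) (+-identityˡ 0#))
    extend-without v ((k , u) ∷ f) with word-eq u v | word-eq-reflects u v
    ... | true  | ofʸ refl = begin
      k * val u + extend f                                   ≈⟨ +-congˡ (extend-without u f) ⟩
      k * val u + (coeff f u * val u + extend (without u f)) ≈⟨ +-assoc _ _ _ ⟨
      k * val u + coeff f u * val u + extend (without u f)   ≈⟨ +-congʳ (distribʳ (val u) k (coeff f u)) ⟨
      (k + coeff f u) * val u + extend (without u f)         ∎
    ... | false | _        = ≈-trans (+-congˡ (extend-without v f)) (x∙yz≈y∙xz _ _ _)

    extend-cong-without : ∀ v f g → SameCoeffs f g →
                          extend (without v f) ≈ extend (without v g) → extend f ≈ extend g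
    extend-cong-without v f g f≐g rest≈ = begin
      extend f                                 ≈⟨ extend-without v f ⟩
      coeff f v * val v + extend (without v f) ≈⟨ +-cong (*-congʳ (f≐g v)) rest≈ ⟩
      coeff g v * val v + extend (without v g) ≈⟨ extend-without v g ⟨
      extend g                                 ∎

    extend-cong : ∀ f g → Acc ℕ._<_ (length f ℕ.+ length g) → SameCoeffs f g → extend f ≈ extend g
    extend-cong []               []               _         _   = ≈-refl
    extend-cong f@((k , v) ∷ f′) g                (acc rec) f≐g =
      extend-cong-without v f g f≐g (extend-cong (without v f) (without v g)
        (rec (ℕ.+-mono-<-≤ (length-without-head k v f′) (length-without v g)))
        (without-sameCoeffs v f g f≐g))
    extend-cong []               g@((k , v) ∷ g′) (acc rec) f≐g =
      extend-cong-without v [] g f≐g (extend-cong [] (without v g)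
        (rec (length-without-head k v g′))
        (without-sameCoeffs v [] g f≐g))

    extend-generator : RespectsWeylRelation val → ∀ g → extend (generator g) ≈ 0#
    extend-generator respects (k , a , b) = begin
      k * val (a ++ D ∷ U ∷ b) + (- k * y + (- k * z + 0#))
        ≈⟨ +-cong (*-congˡ (respects a b)) (+-congˡ (+-identityʳ _)) ⟩
      k * (y + z) + (- k * y + - k * z) ≈⟨ +-congˡ (distribˡ (- k) y z) ⟨
      k * (y + z) + - k * (y + z)       ≈⟨ distribʳ (y + z) k (- k) ⟨
      (k - k) * (y + z)                 ≈⟨ *-congʳ (-‿inverseʳ k) ⟩
      0# * (y + z)                      ≈⟨ zeroˡ (y + z) ⟩
      0#                                ∎
      where
      y z : Carrier
      y = val (a ++ U ∷ D ∷ b)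
      z = val (a ++ b)

    extend-generators : RespectsWeylRelation val → ∀ gs → extend (concatMap generator gs) ≈ 0#
    extend-generators respects []       = ≈-refl
    extend-generators respects (g ∷ gs) = begin
      extend (generator g ++ concatMap generator gs)
        ≈⟨ extend-++ (generator g) (concatMap generator gs) ⟩
      extend (generator g) + extend (concatMap generator gs)
        ≈⟨ +-cong (extend-generator respects g) (extend-generators respects gs) ⟩
      0# + 0#
        ≈⟨ +-identityˡ 0# ⟩
      0# ∎

    extend-ι⊖ι : ∀ v w → extend (ι v ⊖ ι w) ≈ val v - val w
    extend-ι⊖ι v w = +-cong (*-identityˡ (val v)) (≈-trans (+-identityʳ _) (-1*x≈-x (val w)))

    ≈φ⇒≈ : RespectsWeylRelation val → ∀ v w → v ≈φ w → val v ≈ val w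
    ≈φ⇒≈ respects v w (gs , same) = x∙y⁻¹≈ε⇒x≈y (val v) (val w) (begin
      val v - val w                   ≈⟨ extend-ι⊖ι v w ⟨
      extend (ι v ⊖ ι w)
        ≈⟨ extend-cong (ι v ⊖ ι w) (concatMap generator gs) (<-wellFounded _) same ⟩
      extend (concatMap generator gs) ≈⟨ extend-generators respects gs ⟩
      0#                              ∎)

  fromℤ : ℤ → Carrier
  fromℤ (+ n)    = natCast K n
  fromℤ -[1+ n ] = - natCast K (suc n)

  natCast-+ : ∀ m n → natCast K (m ℕ.+ n) ≈ natCast K m + natCast K n
  natCast-+ zero    n = ≈-sym (+-identityˡ _)
  natCast-+ (suc m) n = ≈-trans (+-congˡ (natCast-+ m n)) (≈-sym (+-assoc _ _ _))

  fromℤ-⊖ : ∀ m n → fromℤ (m ℤ.⊖ n) ≈ natCast K m - natCast K n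
  fromℤ-⊖ zero    zero    = ≈-sym (-‿inverseʳ 0#)
  fromℤ-⊖ zero    (suc n) = ≈-sym (+-identityˡ _)
  fromℤ-⊖ (suc m) zero    = ≈-sym (≈-trans (+-congˡ -0#≈0#) (+-identityʳ _))
  fromℤ-⊖ (suc m) (suc n) rewrite ℤ.[1+m]⊖[1+n]≡m⊖n m n = begin
    fromℤ (m ℤ.⊖ n)                       ≈⟨ fromℤ-⊖ m n ⟩
    natCast K m - natCast K n             ≈⟨ +-identityˡ _ ⟨
    0# + (natCast K m - natCast K n)      ≈⟨ +-congʳ (-‿inverseʳ 1#) ⟨
    1# - 1# + (natCast K m - natCast K n) ≈⟨ interchange 1# (- 1#) _ _ ⟩
    1# + natCast K m + (- 1# - natCast K n) ≈⟨ +-congˡ (-‿+-comm 1# (natCast K n)) ⟩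
    1# + natCast K m - (1# + natCast K n) ∎

  fromℤ-+ : ∀ i j → fromℤ (i ℤ.+ j) ≈ fromℤ i + fromℤ j
  fromℤ-+ (+ m)    (+ n)    = natCast-+ m n
  fromℤ-+ (+ m)    -[1+ n ] = fromℤ-⊖ m (suc n)
  fromℤ-+ -[1+ m ] (+ n)    = ≈-trans (fromℤ-⊖ n (suc m)) (+-comm _ _)
  fromℤ-+ -[1+ m ] -[1+ n ] = begin
    - natCast K (suc (suc (m ℕ.+ n)))         ≡⟨ cong (λ k → - natCast K (suc k)) (sym (ℕ.+-suc m n)) ⟩
    - natCast K (suc m ℕ.+ suc n)             ≈⟨ -‿cong (natCast-+ (suc m) (suc n)) ⟩
    - (natCast K (suc m) + natCast K (suc n)) ≈⟨ -‿+-comm _ _ ⟨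
    - natCast K (suc m) - natCast K (suc n)   ∎

  fromℤ≈0⇒≡0 : CharZero K → ∀ i → fromℤ i ≈ 0# → i ≡ 0ℤ
  fromℤ≈0⇒≡0 char0 (+ n)    ≈0 = cong +_ (char0 n ≈0)
  fromℤ≈0⇒≡0 char0 -[1+ n ] ≈0 with () ← char0 (suc n) (begin
    natCast K (suc n)     ≈⟨ -‿involutive _ ⟨
    - - natCast K (suc n) ≈⟨ -‿cong ≈0 ⟩
    - 0#                  ≈⟨ -0#≈0# ⟩
    0#                    ∎)

  fromℤ-injective : CharZero K → ∀ {i j} → fromℤ i ≈ fromℤ j → i ≡ j
  fromℤ-injective char0 {i} {j} i≈j = ℤ.i-j≡0⇒i≡j i j (fromℤ≈0⇒≡0 char0 (i ℤ.- j)
    (+-identityˡ-unique (fromℤ (i ℤ.- j)) (fromℤ j) (begin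
      fromℤ (i ℤ.- j) + fromℤ j ≈⟨ fromℤ-+ (i ℤ.- j) j ⟨
      fromℤ (i ℤ.- j ℤ.+ j)     ≡⟨ cong fromℤ (minus-plus i j) ⟩
      fromℤ i                   ≈⟨ i≈j ⟩
      fromℤ j                   ∎)))
    where
    minus-plus : ∀ i j → i ℤ.- j ℤ.+ j ≡ i
    minus-plus = solve-∀

  ≈φ⇒≡ : CharZero K → (e : Word → ℤ) →
         (∀ a b → e (a ++ D ∷ U ∷ b) ≡ e (a ++ U ∷ D ∷ b) ℤ.+ e (a ++ b)) →
         ∀ v w → v ≈φ w → e v ≡ e w
  ≈φ⇒≡ char0 e e-DU v w = fromℤ-injective char0 ∘ ≈φ⇒≈ (fromℤ ∘ e) respects v w
    where
    open LinearExtension using (≈φ⇒≈)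
    respects : RespectsWeylRelation (fromℤ ∘ e)
    respects a b =
      ≈-trans (reflexive (cong fromℤ (e-DU a b))) (fromℤ-+ (e (a ++ U ∷ D ∷ b)) (e (a ++ b)))

open import Data.Integer.Base using (_+_; _-_; _*_) renaming (suc to sucℤ)
open RingProperties ℤ.+-*-ring using (+-cancelˡ)
open CommutativeSemigroupProperties ℤ.*-commutativeSemigroup using (x∙yz≈y∙xz)

[i-j]*-cancelˡ-≡ : ∀ {i j x y} → i ≢ j → (i - j) * x ≡ (i - j) * y → x ≡ y
[i-j]*-cancelˡ-≡ {i} {j} {x} {y} i≢j = ℤ.*-cancelˡ-≡ (i - j) x y
  where
  instance
    i-j≢0 : NonZero (i - j)
    i-j≢0 = ≢-nonZero (i≢j ∘ ℤ.i-j≡0⇒i≡j i j)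

rootPoly : List ℤ → ℤ → ℤ
rootPoly []      s = 1ℤ
rootPoly (a ∷ A) s = (s - a) * rootPoly A s

rootPoly-root : ∀ A {s} → rootPoly A s ≡ 0ℤ → s ∈ A
rootPoly-root []      ()
rootPoly-root (a ∷ A) {s} ≡0 with ℤ.i*j≡0⇒i≡0∨j≡0 (s - a) ≡0
... | inj₁ s-a≡0 = here (ℤ.i-j≡0⇒i≡j s a s-a≡0)
... | inj₂ ≡0′   = there (rootPoly-root A ≡0′)

rootPoly-∷-head : ∀ a A → rootPoly (a ∷ A) a ≡ 0ℤ
rootPoly-∷-head a A = cong (_* rootPoly A a) (ℤ.+-inverseʳ a)

rootPoly-++-∷ : ∀ B₁ a B₂ s → rootPoly (B₁ ++ a ∷ B₂) s ≡ (s - a) * rootPoly (B₁ ++ B₂) s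
rootPoly-++-∷ []       a B₂ s = refl
rootPoly-++-∷ (b ∷ B₁) a B₂ s = begin
  (s - b) * rootPoly (B₁ ++ a ∷ B₂) s         ≡⟨ cong ((s - b) *_) (rootPoly-++-∷ B₁ a B₂ s) ⟩
  (s - b) * ((s - a) * rootPoly (B₁ ++ B₂) s) ≡⟨ x∙yz≈y∙xz (s - b) (s - a) _ ⟩
  (s - a) * ((s - b) * rootPoly (B₁ ++ B₂) s) ∎
  where open ≡-Reasoning

-- Polynomial functions of degree at most n, defined through divided differences.
IsPoly : ℕ → (ℤ → ℤ) → Set
IsPoly zero    f = ∀ r s → f s ≡ f r
IsPoly (suc n) f = ∀ r → ∃[ q ] IsPoly n q × (∀ s → f s ≡ f r + (s - r) * q s)

const-isPoly : ∀ n c → IsPoly n (const c)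
const-isPoly zero    c r s = refl
const-isPoly (suc n) c r   = const 0ℤ , const-isPoly n 0ℤ , λ s → sym (begin
  c + (s - r) * 0ℤ ≡⟨ cong (_+_ c) (ℤ.*-zeroʳ (s - r)) ⟩
  c + 0ℤ           ≡⟨ ℤ.+-identityʳ c ⟩
  c                ∎)
  where open ≡-Reasoning

+-const-isPoly : ∀ n c {f} → IsPoly n f → IsPoly n (λ s → f s + c)
+-const-isPoly zero    c     f-const r s = cong (_+ c) (f-const r s)
+-const-isPoly (suc n) c {f} f-poly  r with q , q-poly , f≡ ← f-poly r =
  q , q-poly , λ s → trans (cong (_+ c) (f≡ s)) (swap (f r) _ c)
  where
  swap : ∀ x y z → x + y + z ≡ x + z + y
  swap = solve-∀

linear-*-isPoly : ∀ n a {f} → IsPoly n f → IsPoly (suc n) (λ s → (s - a) * f s)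
linear-*-isPoly zero    a {f} f-const r = f , f-const , λ s → begin
  (s - a) * f s                 ≡⟨ cong ((s - a) *_) (f-const r s) ⟩
  (s - a) * f r                 ≡⟨ split s r a (f r) ⟩
  (r - a) * f r + (s - r) * f r ≡⟨ cong (λ x → (r - a) * f r + (s - r) * x) (f-const r s) ⟨
  (r - a) * f r + (s - r) * f s ∎
  where
  open ≡-Reasoning
  split : ∀ s r a x → (s - a) * x ≡ (r - a) * x + (s - r) * x
  split = solve-∀
linear-*-isPoly (suc n) a {f} f-poly  r with q , q-poly , f≡ ← f-poly r =
  (λ s → (s - a) * q s + f r) ,
  +-const-isPoly (suc n) (f r) (linear-*-isPoly n a q-poly) ,
  λ s → trans (cong ((s - a) *_) (f≡ s)) (expand s r a (f r) (q s))
  where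
  expand : ∀ s r a x y → (s - a) * (x + (s - r) * y) ≡ (r - a) * x + (s - r) * ((s - a) * y + x)
  expand = solve-∀

rootPoly-isPoly : ∀ A {n} → length A ≤ n → IsPoly n (rootPoly A)
rootPoly-isPoly []      {n}     _           = const-isPoly n 1ℤ
rootPoly-isPoly (a ∷ A) {suc n} (s≤s |A|≤n) = linear-*-isPoly n a (rootPoly-isPoly A |A|≤n)

fresh : List ℤ → ℤ
fresh E = sucℤ (max 0ℤ E)

fresh-∉ : ∀ E → fresh E ∉ E
fresh-∉ E fresh∈E = ℤ.<-irrefl refl (ℤ.suc[i]≤j⇒i<j (All.lookup (xs≤max 0ℤ E) fresh∈E))

-- Generalising over the finite exceptional set E makes the induction work: the difference
-- quotients at r agree away from r ∷ E.
isPoly-unique : ∀ n E {f g} → IsPoly n f → IsPoly n g →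
                (∀ s → s ∉ E → f s ≡ g s) → ∀ s → f s ≡ g s
isPoly-unique zero    E {f} {g} f-const g-const f≡g s =
  trans (f-const (fresh E) s) (trans (f≡g (fresh E) (fresh-∉ E)) (sym (g-const (fresh E) s)))
isPoly-unique (suc n) E {f} {g} f-poly  g-poly  f≡g s
  with p , p-poly , f≡ ← f-poly (fresh E) | q , q-poly , g≡ ← g-poly (fresh E) = begin
    f s                 ≡⟨ f≡ s ⟩
    f r + (s - r) * p s ≡⟨ cong₂ (λ x y → x + (s - r) * y) fr≡gr (p≡q s) ⟩
    g r + (s - r) * q s ≡⟨ g≡ s ⟨
    g s                 ∎
  where
  open ≡-Reasoning
  r : ℤ
  r = fresh E
  fr≡gr : f r ≡ g r
  fr≡gr = f≡g r (fresh-∉ E)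
  p≡q : ∀ s → p s ≡ q s
  p≡q = isPoly-unique n (r ∷ E) p-poly q-poly λ t t∉r∷E →
    [i-j]*-cancelˡ-≡ (t∉r∷E ∘ here) (+-cancelˡ (g r) _ _ (begin
      g r + (t - r) * p t ≡⟨ cong (λ x → x + (t - r) * p t) fr≡gr ⟨
      f r + (t - r) * p t ≡⟨ f≡ t ⟨
      f t                 ≡⟨ f≡g t (t∉r∷E ∘ there) ⟩
      g t                 ≡⟨ g≡ t ⟩
      g r + (t - r) * q t ∎))

rootPoly-injective : ∀ A B → (∀ s → rootPoly A s ≡ rootPoly B s) → A ↭ B
rootPoly-injective []      []      _   = ↭-refl
rootPoly-injective []      (b ∷ B) A≗B with () ← trans (A≗B b) (rootPoly-∷-head b B)
rootPoly-injective (a ∷ A) B       A≗B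
  with B₁ , B₂ , refl ← ∈-∃++ (rootPoly-root B (trans (sym (A≗B a)) (rootPoly-∷-head a A))) =
  ↭-trans (prep a (rootPoly-injective A (B₁ ++ B₂) A≗B′)) (↭-sym (shift a B₁ B₂))
  where
  A≗B′ : ∀ s → rootPoly A s ≡ rootPoly (B₁ ++ B₂) s
  A≗B′ = isPoly-unique (length A ℕ.+ length (B₁ ++ B₂)) [ a ]
    (rootPoly-isPoly A (ℕ.m≤m+n _ _)) (rootPoly-isPoly (B₁ ++ B₂) (ℕ.m≤n+m _ _))
    λ s s∉[a] → [i-j]*-cancelˡ-≡ (s∉[a] ∘ here) (trans (A≗B s) (rootPoly-++-∷ B₁ a B₂ s))

module _ (s : ℤ) (t : ℤ → ℤ) where

  eval : ℤ → Word → ℤ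
  eval h []      = t h
  eval h (U ∷ w) = (s - h) * eval (h + 1ℤ) w
  eval h (D ∷ w) = eval (h - 1ℤ) w

  eval-DU : ∀ h a b → eval h (a ++ D ∷ U ∷ b) ≡ eval h (a ++ U ∷ D ∷ b) + eval h (a ++ b)
  eval-DU h []      b = begin
    (s - (h - 1ℤ)) * eval (h - 1ℤ + 1ℤ) b     ≡⟨ cong (λ h′ → (s - (h - 1ℤ)) * eval h′ b) (down-up h) ⟩
    (s - (h - 1ℤ)) * eval h b                 ≡⟨ commutator s h (eval h b) ⟩
    (s - h) * eval h b + eval h b             ≡⟨ cong (λ h′ → (s - h) * eval h′ b + eval h b) (up-down h) ⟨
    (s - h) * eval (h + 1ℤ - 1ℤ) b + eval h b ∎
    where
    open ≡-Reasoning
    down-up : ∀ h → h - 1ℤ + 1ℤ ≡ h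
    down-up = solve-∀
    up-down : ∀ h → h + 1ℤ - 1ℤ ≡ h
    up-down = solve-∀
    commutator : ∀ s h x → (s - (h - 1ℤ)) * x ≡ (s - h) * x + x
    commutator = solve-∀
  eval-DU h (U ∷ a) b =
    trans (cong ((s - h) *_) (eval-DU (h + 1ℤ) a b)) (ℤ.*-distribˡ-+ (s - h) _ _)
  eval-DU h (D ∷ a) b = eval-DU (h - 1ℤ) a b

  eval-steps : ∀ p ss → eval (ht p) (map readStep ss) ≡
                        rootPoly (upHeightsFrom p ss) s * t (ht (endpoint p ss))
  eval-steps (x , y) []       = sym (ℤ.*-identityˡ (t y))
  eval-steps (x , y) (↗ ∷ ss) =
    trans (cong ((s - y) *_) (eval-steps (move ↗ (x , y)) ss)) (sym (ℤ.*-assoc (s - y) _ _))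
  eval-steps (x , y) (↘ ∷ ss) = eval-steps (move ↘ (x , y)) ss

upHeights-invariant : ∀ {c ℓ} (K : Field c ℓ) → CharZero K → (p q : DiagPath) →
  initialHeight p ≡ initialHeight q → Weyl._≈φ_ K (readingWord p) (readingWord q) →
  ∀ s t → rootPoly (upHeights p) s * t (finalHeight p) ≡
          rootPoly (upHeights q) s * t (finalHeight q)
upHeights-invariant K char0 (mkPath (x , y) ss) (mkPath (x′ , .y) ts) refl p≈q s t = begin
  rootPoly (upHeightsFrom (x , y) ss) s * t (ht (endpoint (x , y) ss))
    ≡⟨ eval-steps s t (x , y) ss ⟨
  eval s t y (map readStep ss)
    ≡⟨ ≈φ⇒≡ K char0 (eval s t y) (eval-DU s t y) (map readStep ss) (map readStep ts) p≈q ⟩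
  eval s t y (map readStep ts)
    ≡⟨ eval-steps s t (x′ , y) ts ⟩
  rootPoly (upHeightsFrom (x′ , y) ts) s * t (ht (endpoint (x′ , y) ts)) ∎
  where open ≡-Reasoning

proposition3p6 : ∀ {c ℓ : Level} (K : Field c ℓ) → CharZero K →
    (p q : DiagPath) →
    initialHeight p ≡ initialHeight q →
    Weyl._≈φ_ K (readingWord p) (readingWord q) →
    (finalHeight p ≡ finalHeight q) × (upHeights p ↭ upHeights q)
proposition3p6 K char0 p q p₀≡q₀ p≈q = finalHeight-≡ , rootPoly-injective A B A≗B
  where
  A B : List ℤ
  A = upHeights p
  B = upHeights q
  invariant : ∀ s t → rootPoly A s * t (finalHeight p) ≡ rootPoly B s * t (finalHeight q)
  invariant = upHeights-invariant K char0 p q p₀≡q₀ p≈q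
  A≗B : ∀ s → rootPoly A s ≡ rootPoly B s
  A≗B s = ℤ.*-cancelʳ-≡ _ _ 1ℤ (invariant s (const 1ℤ))
  s₀ : ℤ
  s₀ = fresh A
  instance
    A[s₀]≢0 : NonZero (rootPoly A s₀)
    A[s₀]≢0 = ≢-nonZero (fresh-∉ A ∘ rootPoly-root A)
  finalHeight-≡ : finalHeight p ≡ finalHeight q
  finalHeight-≡ = ℤ.*-cancelˡ-≡ (rootPoly A s₀) _ _
    (trans (invariant s₀ id) (cong (_* finalHeight q) (sym (A≗B s₀))))
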